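{- For every $\pi\in\mathfrak{S}_n$, $\mathcal{S}'(\pi)=\mathcal{S}(\pi)$.
   Context: Stack-sorting: $\mathcal{S}(\emptyset)=\emptyset$, $\mathcal{S}(\alpha\,m\,\beta)=\mathcal{S}(\alpha)\mathcal{S}(\beta)m$ with $m$ the largest letter. For a permutation (word with distinct letters) $\pi$, a descent top is a letter $\pi_i$ with $\pi_i>\pi_{i+1}$; let $\mathsf{DT}(\pi)=\{b_1<b_2<\cdots<b_k\}$ be the set of descent tops of $\pi$. For a letter $b$ of a current word, $\mathsf{rfp}(b)$ is the first letter to the right of $b$ that is larger than $b$ (if it exists). The relocation $\mathcal{S}_b$ applied to a word moves $b$ to the position immediately before $\mathsf{rfp}(b)$ if $\mathsf{rfp}(b)$ exists, and otherwise moves $b$ to the end of the word. Define $\mathcal{S}'(\pi)=\mathcal{S}_{b_k}\circ\mathcal{S}_{b_{k-1}}\circ\cdots\circ\mathcal{S}_{b_1}(\pi)$, where each $\mathcal{S}_{b_j}$ is applied to the word produced by the previous relocations. -}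

module Defs where

open import Data.Nat using (ℕ; zero; suc; _⊔_; _<ᵇ_; _≡ᵇ_)
open import Data.Bool using (Bool; true; false; if_then_else_)
open import Data.List using (List; []; _∷_; _++_; [_]; length; foldr; foldl)
open import Data.Product using (_×_; _,_)

maxLetter : List ℕ → ℕ
maxLetter = foldr _⊔_ 0

splitAt∈ : ℕ → List ℕ → List ℕ × List ℕ
splitAt∈ m [] = [] , []
splitAt∈ m (y ∷ ys) with y ≡ᵇ m
... | true  = [] , ys
... | false with splitAt∈ m ys
...   | α , β = y ∷ α , β

-- Stack-sorting, by the recursion S(∅)=∅, S(α m β) = S(α) S(β) m
-- (m the largest letter). The fuel argument only ensures termination;
-- the length of the word is always sufficient fuel.
stackSortFuel : ℕ → List ℕ → List ℕ
stackSortFuel zero    w  = []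
stackSortFuel (suc f) [] = []
stackSortFuel (suc f) (x ∷ xs) with splitAt∈ (maxLetter (x ∷ xs)) (x ∷ xs)
... | α , β = stackSortFuel f α ++ stackSortFuel f β ++ [ maxLetter (x ∷ xs) ]

stackSort : List ℕ → List ℕ
stackSort w = stackSortFuel (length w) w

descentTopsList : List ℕ → List ℕ
descentTopsList [] = []
descentTopsList (x ∷ []) = []
descentTopsList (x ∷ y ∷ rest) =
  if y <ᵇ x then x ∷ descentTopsList (y ∷ rest) else descentTopsList (y ∷ rest)

insertInc : ℕ → List ℕ → List ℕ
insertInc b [] = [ b ]
insertInc b (c ∷ cs) = if c <ᵇ b then c ∷ insertInc b cs else b ∷ c ∷ cs

sortInc : List ℕ → List ℕ
sortInc = foldr insertInc []

DT : List ℕ → List ℕ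
DT π = sortInc (descentTopsList π)

insertBeforeRfp : ℕ → List ℕ → List ℕ
insertBeforeRfp b [] = [ b ]
insertBeforeRfp b (c ∷ δ) = if b <ᵇ c then b ∷ c ∷ δ else c ∷ insertBeforeRfp b δ

relocate : ℕ → List ℕ → List ℕ
relocate b w with splitAt∈ b w
... | α , β = α ++ insertBeforeRfp b β

stackSort′ : List ℕ → List ℕ
stackSort′ π = foldl (λ w b → relocate b w) π (DT π)

-- permutations in 𝔖_n, in one-line notation: words that are a
-- rearrangement of 1 2 ⋯ n

module Submission where

-- Write π = α m β with m its largest letter. The descent tops of π are those of α, those
-- of β, and m itself when β is nonempty; in increasing order m comes last. A letter b of α
-- has rfp(b) inside α or equal to m, and a letter of β has it inside β, so the relocations
-- of the tops of α and of β act independently on the two sides, each in the order given by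
-- DT of that side; this yields S'(α) m S'(β). The final relocation of m sends it to the end
-- of the word, so S'(π) = S'(α) S'(β) m, which is the recursion defining S.

open import Defs
open import Data.Bool using (true; false)
open import Data.Bool.Properties using (T-≡; ¬-not)
open import Data.Nat using (ℕ; zero; suc; _+_; _<_; _≤_; _<ᵇ_; _≡ᵇ_)
open import Data.Nat.Properties
open import Data.List using (List; []; _∷_; _++_; [_]; length; foldl; filter; map; upTo)
open import Data.List.Properties using (++-assoc; ++-identityʳ; filter-++; filter-all; filter-none; foldl-++; length-++)
open import Data.List.Membership.Propositional using (_∈_; _∉_)
open import Data.List.Membership.Propositional.Properties using (∈-++⁻; ∈-++⁺ˡ; ∈-++⁺ʳ)
open import Data.List.Membership.DecPropositional _≟_ using (_∈?_)
open import Data.List.Relation.Unary.Any using (here; there)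
open import Data.List.Relation.Unary.All as All using (All; []; _∷_)
import Data.List.Relation.Unary.All.Properties as All
open import Data.List.Relation.Unary.AllPairs using (AllPairs; []; _∷_)
import Data.List.Relation.Unary.AllPairs.Properties as AllPairs
open import Data.List.Relation.Unary.Unique.Propositional using (Unique)
import Data.List.Relation.Unary.Unique.Propositional.Properties as Unique
open import Data.List.Relation.Unary.Sorted.TotalOrder.Properties using (AllPairs⇒Sorted; ↗↭↗⇒≋)
open import Data.List.Relation.Binary.Pointwise using (Pointwise-≡⇒≡)
open import Data.List.Relation.Binary.Subset.Propositional using (_⊆_)
open import Data.List.Relation.Binary.Subset.Propositional.Properties using (∷⁺ʳ)
open import Data.List.Relation.Binary.Disjoint.Propositional using (Disjoint; contractᵣ)
open import Data.List.Relation.Binary.Permutation.Propositional using (_↭_; ↭-refl; ↭-sym; ↭-trans; prep; swap; ↭⇒↭ₛ; ↭⇒↭ₛ′)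
open import Data.List.Relation.Binary.Permutation.Propositional.Properties using (All-resp-↭; ∈-resp-↭; filter-↭; ++-comm; ++⁺ˡ; ++⁺ʳ; shift)
open import Data.Product using (_×_; _,_; proj₁; proj₂; ∃₂)
open import Data.Sum using (inj₁; inj₂)
open import Function using (_∘_; id; Equivalence)
open import Relation.Nullary using (¬_; yes; no; ofʸ; ofⁿ; contradiction)
open import Relation.Unary using (Pred; Decidable; ∁)
open import Relation.Unary.Properties using (∁?)
open import Relation.Binary.PropositionalEquality using (_≡_; _≢_; refl; sym; trans; cong; cong₂; subst; setoid; isEquivalence; module ≡-Reasoning)
open import Data.List.Relation.Binary.Permutation.Setoid.Properties (setoid ℕ) using (Unique-resp-↭)

<⇒<ᵇ≡true : ∀ {m n} → m < n → (m <ᵇ n) ≡ true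
<⇒<ᵇ≡true = Equivalence.to T-≡ ∘ <⇒<ᵇ

≤⇒<ᵇ≡false : ∀ {m n} → n ≤ m → (m <ᵇ n) ≡ false
≤⇒<ᵇ≡false {m} {n} n≤m = ¬-not (≤⇒≯ n≤m ∘ <ᵇ⇒< m n ∘ Equivalence.from T-≡)

≡ᵇ-refl : ∀ n → (n ≡ᵇ n) ≡ true
≡ᵇ-refl n = Equivalence.to T-≡ (≡⇒≡ᵇ n n refl)

≢⇒≡ᵇ≡false : ∀ {m n} → m ≢ n → (m ≡ᵇ n) ≡ false
≢⇒≡ᵇ≡false {m} {n} m≢n = ¬-not (m≢n ∘ ≡ᵇ⇒≡ m n ∘ Equivalence.from T-≡)

filter-++-partition : ∀ {p} {P : Pred ℕ p} (P? : Decidable P) {xs ys} → All P xs → All (∁ P) ys →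
                      filter P? (xs ++ ys) ≡ xs × filter (∁? P?) (xs ++ ys) ≡ ys
filter-++-partition P? {xs} {ys} Pxs ¬Pys =
  trans (filter-++ P? xs ys) (trans (cong₂ _++_ (filter-all P? Pxs) (filter-none P? ¬Pys)) (++-identityʳ xs)) ,
  trans (filter-++ (∁? P?) xs ys)
        (cong₂ _++_ (filter-none (∁? P?) (All.map (λ Px ¬Px → ¬Px Px) Pxs)) (filter-all (∁? P?) ¬Pys))

Unique-++⁻ : ∀ xs {ys : List ℕ} → Unique (xs ++ ys) → Unique xs × Unique ys × Disjoint xs ys
Unique-++⁻ []       u          = [] , u , λ ()
Unique-++⁻ (x ∷ xs) (x≢ ∷ u) with Unique-++⁻ xs u | All.++⁻ xs x≢
... | uxs , uys , disjoint | x≢xs , x≢ys = x≢xs ∷ uxs , uys , λ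
  { (here refl , v∈ys)  → All.lookup x≢ys v∈ys refl
  ; (there v∈xs , v∈ys) → disjoint (v∈xs , v∈ys) }

insertInc-↭ : ∀ b xs → insertInc b xs ↭ b ∷ xs
insertInc-↭ b [] = ↭-refl
insertInc-↭ b (c ∷ cs) with c <ᵇ b
... | true  = ↭-trans (prep c (insertInc-↭ b cs)) (swap c b ↭-refl)
... | false = ↭-refl

sortInc-↭ : ∀ xs → sortInc xs ↭ xs
sortInc-↭ []       = ↭-refl
sortInc-↭ (x ∷ xs) = ↭-trans (insertInc-↭ x (sortInc xs)) (prep x (sortInc-↭ xs))

insertInc-sorted : ∀ b {xs} → AllPairs _≤_ xs → AllPairs _≤_ (insertInc b xs)
insertInc-sorted b [] = [] ∷ []
insertInc-sorted b {c ∷ cs} (c≤cs ∷ cs↗) with c <ᵇ b | <ᵇ-reflects-< c b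
... | true  | ofʸ c<b = All-resp-↭ (↭-sym (insertInc-↭ b cs)) (<⇒≤ c<b ∷ c≤cs) ∷ insertInc-sorted b cs↗
... | false | ofⁿ c≮b = (b≤c ∷ All.map (≤-trans b≤c) c≤cs) ∷ c≤cs ∷ cs↗
  where b≤c = ≮⇒≥ c≮b

sortInc-sorted : ∀ xs → AllPairs _≤_ (sortInc xs)
sortInc-sorted []       = []
sortInc-sorted (x ∷ xs) = insertInc-sorted x (sortInc-sorted xs)

sortInc-unique : ∀ {xs ys} → AllPairs _≤_ ys → ys ↭ xs → sortInc xs ≡ ys
sortInc-unique {xs} ys↗ ys↭xs = Pointwise-≡⇒≡ (↗↭↗⇒≋ ≤-totalOrder
  (AllPairs⇒Sorted ≤-totalOrder (sortInc-sorted xs)) (AllPairs⇒Sorted ≤-totalOrder ys↗)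
  (↭⇒↭ₛ′ isEquivalence (↭-trans (sortInc-↭ xs) (↭-sym ys↭xs))))

filter-sortInc : ∀ {p} {P : Pred ℕ p} (P? : Decidable P) xs → filter P? (sortInc xs) ≡ sortInc (filter P? xs)
filter-sortInc P? xs =
  sym (sortInc-unique (AllPairs.filter⁺ P? (sortInc-sorted xs)) (filter-↭ P? (sortInc-↭ xs)))

sortInc-++-∷ : ∀ {m} xs ys → All (_≤ m) xs → All (_≤ m) ys → sortInc (xs ++ m ∷ ys) ≡ sortInc (xs ++ ys) ++ [ m ]
sortInc-++-∷ {m} xs ys xs≤m ys≤m = sortInc-unique
  (AllPairs.++⁺ (sortInc-sorted (xs ++ ys)) ([] ∷ [])
     (All.map (_∷ []) (All-resp-↭ (↭-sym (sortInc-↭ (xs ++ ys))) (All.++⁺ xs≤m ys≤m))))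
  (↭-trans (++⁺ʳ [ m ] (sortInc-↭ (xs ++ ys))) (↭-trans (++-comm (xs ++ ys) [ m ]) (↭-sym (shift m xs ys))))

∈⇒first-occurrence : ∀ {b : ℕ} {w} → b ∈ w → ∃₂ λ α β → b ∉ α × w ≡ α ++ b ∷ β
∈⇒first-occurrence {b} {y ∷ ys} b∈w with y ≟ b | b∈w
... | yes refl | _          = [] , ys , (λ ()) , refl
... | no y≢b   | here refl  = contradiction refl y≢b
... | no y≢b   | there b∈ys with ∈⇒first-occurrence b∈ys
...   | α , β , b∉α , refl = y ∷ α , β , b∉yα , refl
  where
  b∉yα : b ∉ y ∷ α
  b∉yα (here refl)  = y≢b refl
  b∉yα (there b∈α) = b∉α b∈α

splitAt∈-++-∷ : ∀ {b} α β → b ∉ α → splitAt∈ b (α ++ b ∷ β) ≡ (α , β)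
splitAt∈-++-∷ {b} [] β _ rewrite ≡ᵇ-refl b = refl
splitAt∈-++-∷ {b} (y ∷ α) β b∉yα
  rewrite ≢⇒≡ᵇ≡false {y} {b} (λ { refl → b∉yα (here refl) })
        | splitAt∈-++-∷ α β (b∉yα ∘ there) = refl

relocate-++-∷ : ∀ {b} α β → b ∉ α → relocate b (α ++ b ∷ β) ≡ α ++ insertBeforeRfp b β
relocate-++-∷ α β b∉α rewrite splitAt∈-++-∷ α β b∉α = refl

insertBeforeRfp-↭ : ∀ b xs → insertBeforeRfp b xs ↭ b ∷ xs
insertBeforeRfp-↭ b [] = ↭-refl
insertBeforeRfp-↭ b (c ∷ cs) with b <ᵇ c
... | true  = ↭-refl
... | false = ↭-trans (prep c (insertBeforeRfp-↭ b cs)) (swap c b ↭-refl)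

relocate-↭ : ∀ {b w} → b ∈ w → relocate b w ↭ w
relocate-↭ {b} b∈w with ∈⇒first-occurrence b∈w
... | α , β , b∉α , refl rewrite relocate-++-∷ α β b∉α = ++⁺ˡ α (insertBeforeRfp-↭ b β)

insertBeforeRfp-++-∷ : ∀ {b m} xs ys → b < m → insertBeforeRfp b (xs ++ m ∷ ys) ≡ insertBeforeRfp b xs ++ m ∷ ys
insertBeforeRfp-++-∷ [] ys b<m rewrite <⇒<ᵇ≡true b<m = refl
insertBeforeRfp-++-∷ {b} (c ∷ cs) ys b<m with b <ᵇ c
... | true  = refl
... | false = cong (c ∷_) (insertBeforeRfp-++-∷ cs ys b<m)

insertBeforeRfp-max : ∀ {b} ys → All (_< b) ys → insertBeforeRfp b ys ≡ ys ++ [ b ]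
insertBeforeRfp-max []       []            = refl
insertBeforeRfp-max (c ∷ cs) (c<b ∷ cs<b) rewrite ≤⇒<ᵇ≡false (<⇒≤ c<b) =
  cong (c ∷_) (insertBeforeRfp-max cs cs<b)

relocate-++-∷ˡ : ∀ {b m} α β → b ∈ α → b < m → relocate b (α ++ m ∷ β) ≡ relocate b α ++ m ∷ β
relocate-++-∷ˡ {b} {m} _ β b∈α b<m with ∈⇒first-occurrence b∈α
... | α₁ , α₂ , b∉α₁ , refl = begin
  relocate b ((α₁ ++ b ∷ α₂) ++ m ∷ β)   ≡⟨ cong (relocate b) (++-assoc α₁ (b ∷ α₂) (m ∷ β)) ⟩
  relocate b (α₁ ++ b ∷ α₂ ++ m ∷ β)     ≡⟨ relocate-++-∷ α₁ (α₂ ++ m ∷ β) b∉α₁ ⟩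
  α₁ ++ insertBeforeRfp b (α₂ ++ m ∷ β)  ≡⟨ cong (α₁ ++_) (insertBeforeRfp-++-∷ α₂ β b<m) ⟩
  α₁ ++ insertBeforeRfp b α₂ ++ m ∷ β    ≡⟨ ++-assoc α₁ (insertBeforeRfp b α₂) (m ∷ β) ⟨
  (α₁ ++ insertBeforeRfp b α₂) ++ m ∷ β  ≡⟨ cong (_++ m ∷ β) (relocate-++-∷ α₁ α₂ b∉α₁) ⟨
  relocate b (α₁ ++ b ∷ α₂) ++ m ∷ β     ∎
  where open ≡-Reasoning

relocate-++-∷ʳ : ∀ {b m} α β → b ∉ α → b ≢ m → b ∈ β → relocate b (α ++ m ∷ β) ≡ α ++ m ∷ relocate b β
relocate-++-∷ʳ {b} {m} α _ b∉α b≢m b∈β with ∈⇒first-occurrence b∈β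
... | β₁ , β₂ , b∉β₁ , refl = begin
  relocate b (α ++ m ∷ β₁ ++ b ∷ β₂)     ≡⟨ cong (relocate b) (++-assoc α (m ∷ β₁) (b ∷ β₂)) ⟨
  relocate b ((α ++ m ∷ β₁) ++ b ∷ β₂)   ≡⟨ relocate-++-∷ (α ++ m ∷ β₁) β₂ b∉αmβ₁ ⟩
  (α ++ m ∷ β₁) ++ insertBeforeRfp b β₂  ≡⟨ ++-assoc α (m ∷ β₁) (insertBeforeRfp b β₂) ⟩
  α ++ m ∷ β₁ ++ insertBeforeRfp b β₂    ≡⟨ cong (λ γ → α ++ m ∷ γ) (relocate-++-∷ β₁ β₂ b∉β₁) ⟨
  α ++ m ∷ relocate b (β₁ ++ b ∷ β₂)     ∎
  where
  open ≡-Reasoning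
  b∉αmβ₁ : b ∉ α ++ m ∷ β₁
  b∉αmβ₁ b∈ with ∈-++⁻ α b∈
  ... | inj₁ b∈α          = b∉α b∈α
  ... | inj₂ (here b≡m)   = b≢m b≡m
  ... | inj₂ (there b∈β₁) = b∉β₁ b∈β₁

relocate-max : ∀ {m} α β → m ∉ α → All (_< m) β → relocate m (α ++ m ∷ β) ≡ α ++ β ++ [ m ]
relocate-max α β m∉α β<m = trans (relocate-++-∷ α β m∉α) (cong (α ++_) (insertBeforeRfp-max β β<m))

relocateAll : List ℕ → List ℕ → List ℕ
relocateAll bs w = foldl (λ w b → relocate b w) w bs

relocateAll-↭ : ∀ bs {w} → All (_∈ w) bs → relocateAll bs w ↭ w
relocateAll-↭ []       []               = ↭-refl
relocateAll-↭ (b ∷ bs) (b∈w ∷ bs∈w) =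
  ↭-trans (relocateAll-↭ bs (All.map (∈-resp-↭ (↭-sym (relocate-↭ b∈w))) bs∈w)) (relocate-↭ b∈w)

-- P marks the letters to the left of m; it is fixed while the left part itself
-- changes under the relocations, which is why the split is by a predicate.
module _ {p} {P : Pred ℕ p} (P? : Decidable P) {m : ℕ} where

  relocateAll-++-∷ : ∀ bs α β → All (_< m) α → All (_< m) β → All P α →
    All (λ b → (P b → b ∈ α) × (¬ P b → b ∈ β)) bs →
    relocateAll bs (α ++ m ∷ β) ≡ relocateAll (filter P? bs) α ++ m ∷ relocateAll (filter (∁? P?) bs) β
  relocateAll-++-∷ [] α β _ _ _ [] = refl
  relocateAll-++-∷ (b ∷ bs) α β α<m β<m Pα ((inα , inβ) ∷ bs-sides) with P? b
  ... | yes Pb = trans (cong (relocateAll bs) (relocate-++-∷ˡ α β b∈α (All.lookup α<m b∈α)))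
    (relocateAll-++-∷ bs (relocate b α) β (resp α<m) β<m (resp Pα)
      (All.map (λ (inα , inβ) → ∈-resp-↭ (↭-sym α′↭α) ∘ inα , inβ) bs-sides))
    where
    b∈α = inα Pb
    α′↭α = relocate-↭ b∈α
    resp : ∀ {q} {Q : Pred ℕ q} → All Q α → All Q (relocate b α)
    resp = All-resp-↭ (↭-sym α′↭α)
  ... | no ¬Pb = trans (cong (relocateAll bs) (relocate-++-∷ʳ α β b∉α b≢m b∈β))
    (relocateAll-++-∷ bs α (relocate b β) α<m (All-resp-↭ (↭-sym β′↭β) β<m) Pα
      (All.map (λ (inα , inβ) → inα , ∈-resp-↭ (↭-sym β′↭β) ∘ inβ) bs-sides))
    where
    b∈β = inβ ¬Pb
    β′↭β = relocate-↭ b∈β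
    b∉α : b ∉ α
    b∉α b∈α = ¬Pb (All.lookup Pα b∈α)
    b≢m : b ≢ m
    b≢m = <⇒≢ (All.lookup β<m b∈β)

descentTopsList-⊆-∷ : ∀ a b r → descentTopsList (a ∷ b ∷ r) ⊆ a ∷ descentTopsList (b ∷ r)
descentTopsList-⊆-∷ a b r x∈ with b <ᵇ a
... | true  = x∈
... | false = there x∈

descentTopsList-⊆ : ∀ w → descentTopsList w ⊆ w
descentTopsList-⊆ []          ()
descentTopsList-⊆ (a ∷ [])    ()
descentTopsList-⊆ (a ∷ b ∷ r) = ∷⁺ʳ a (descentTopsList-⊆ (b ∷ r)) ∘ descentTopsList-⊆-∷ a b r

All-descentTopsList : ∀ {p} {P : Pred ℕ p} w → All P w → All P (descentTopsList w)
All-descentTopsList w Pw = All.tabulate (All.lookup Pw ∘ descentTopsList-⊆ w)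

descentTopsList-++-∷ : ∀ {m} α β → All (_< m) α →
                       descentTopsList (α ++ m ∷ β) ≡ descentTopsList α ++ descentTopsList (m ∷ β)
descentTopsList-++-∷ []          β [] = refl
descentTopsList-++-∷ (x ∷ [])    β (x<m ∷ []) rewrite ≤⇒<ᵇ≡false (<⇒≤ x<m) = refl
descentTopsList-++-∷ (x ∷ y ∷ r) β (_ ∷ yr<m) with y <ᵇ x
... | true  = cong (x ∷_) (descentTopsList-++-∷ (y ∷ r) β yr<m)
... | false = descentTopsList-++-∷ (y ∷ r) β yr<m

descentTopsList-∷-∷ : ∀ {m y} r → y < m → descentTopsList (m ∷ y ∷ r) ≡ m ∷ descentTopsList (y ∷ r)
descentTopsList-∷-∷ r y<m rewrite <⇒<ᵇ≡true y<m = refl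

stackSort′-↭ : ∀ w → stackSort′ w ↭ w
stackSort′-↭ w = relocateAll-↭ (DT w)
  (All-resp-↭ (↭-sym (sortInc-↭ (descentTopsList w))) (All.tabulate (descentTopsList-⊆ w)))

relocateAll-around-max : ∀ {m} α β → Unique (α ++ m ∷ β) → All (_< m) α → All (_< m) β →
  relocateAll (sortInc (descentTopsList α ++ descentTopsList β)) (α ++ m ∷ β) ≡ stackSort′ α ++ m ∷ stackSort′ β
relocateAll-around-max {m} α β u α<m β<m =
  trans (relocateAll-++-∷ (_∈? α) (sortInc (dα ++ dβ)) α β α<m β<m (All.tabulate id) sides)
        (cong₂ (λ bsα bsβ → relocateAll bsα α ++ m ∷ relocateAll bsβ β)
               (trans (filter-sortInc (_∈? α) (dα ++ dβ)) (cong sortInc (proj₁ partition)))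
               (trans (filter-sortInc (∁? (_∈? α)) (dα ++ dβ)) (cong sortInc (proj₂ partition))))
  where
  dα = descentTopsList α
  dβ = descentTopsList β
  disjoint : Disjoint α β
  disjoint = contractᵣ (proj₂ (proj₂ (Unique-++⁻ α u)))
  partition = filter-++-partition (_∈? α) (All.tabulate (descentTopsList-⊆ α))
                (All.tabulate λ x∈dβ x∈α → disjoint (x∈α , descentTopsList-⊆ β x∈dβ))
  outside-α-in-β : ∀ {b} → b ∈ dα ++ dβ → b ∉ α → b ∈ β
  outside-α-in-β b∈d b∉α with ∈-++⁻ dα b∈d
  ... | inj₁ b∈dα = contradiction (descentTopsList-⊆ α b∈dα) b∉α
  ... | inj₂ b∈dβ = descentTopsList-⊆ β b∈dβ
  sides : All (λ b → (b ∈ α → b ∈ α) × (b ∉ α → b ∈ β)) (sortInc (dα ++ dβ))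
  sides = All-resp-↭ (↭-sym (sortInc-↭ (dα ++ dβ))) (All.tabulate λ b∈d → id , outside-α-in-β b∈d)

stackSort′-++-∷ : ∀ {m} α β → Unique (α ++ m ∷ β) → All (_< m) α → All (_< m) β →
  stackSort′ (α ++ m ∷ β) ≡ stackSort′ α ++ stackSort′ β ++ [ m ]
stackSort′-++-∷ {m} α [] u α<m [] =
  trans (cong (λ d → relocateAll (sortInc d) (α ++ [ m ])) (descentTopsList-++-∷ α [] α<m))
        (relocateAll-around-max α [] u α<m [])
stackSort′-++-∷ {m} α β@(y ∷ r) u α<m β<m@(y<m ∷ _) = begin
  relocateAll (sortInc (descentTopsList w)) w
    ≡⟨ cong (λ d → relocateAll (sortInc d) w)
            (trans (descentTopsList-++-∷ α β α<m) (cong (dα ++_) (descentTopsList-∷-∷ r y<m))) ⟩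
  relocateAll (sortInc (dα ++ m ∷ dβ)) w
    ≡⟨ cong (λ bs → relocateAll bs w) (sortInc-++-∷ dα dβ (tops≤m α α<m) (tops≤m β β<m)) ⟩
  relocateAll (sortInc (dα ++ dβ) ++ [ m ]) w
    ≡⟨ foldl-++ (λ w b → relocate b w) w (sortInc (dα ++ dβ)) [ m ] ⟩
  relocate m (relocateAll (sortInc (dα ++ dβ)) w)
    ≡⟨ cong (relocate m) (relocateAll-around-max α β u α<m β<m) ⟩
  relocate m (stackSort′ α ++ m ∷ stackSort′ β)
    ≡⟨ relocate-max (stackSort′ α) (stackSort′ β) m∉α′ (All-resp-↭ (↭-sym (stackSort′-↭ β)) β<m) ⟩
  stackSort′ α ++ stackSort′ β ++ [ m ] ∎
  where
  open ≡-Reasoning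
  w = α ++ m ∷ β
  dα = descentTopsList α
  dβ = descentTopsList β
  tops≤m : ∀ γ → All (_< m) γ → All (_≤ m) (descentTopsList γ)
  tops≤m γ γ<m = All.map <⇒≤ (All-descentTopsList γ γ<m)
  m∉α′ : m ∉ stackSort′ α
  m∉α′ m∈ = <-irrefl refl (All.lookup α<m (∈-resp-↭ (stackSort′-↭ α) m∈))

≤-maxLetter : ∀ {x} w → x ∈ w → x ≤ maxLetter w
≤-maxLetter (y ∷ ys) (here refl)  = m≤m⊔n y (maxLetter ys)
≤-maxLetter (y ∷ ys) (there x∈ys) = ≤-trans (≤-maxLetter ys x∈ys) (m≤n⊔m y (maxLetter ys))

maxLetter-∈ : ∀ x xs → maxLetter (x ∷ xs) ∈ x ∷ xs
maxLetter-∈ x [] = here (⊔-identityʳ x)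
maxLetter-∈ x (y ∷ ys) with ⊔-sel x (maxLetter (y ∷ ys))
... | inj₁ eq = here eq
... | inj₂ eq rewrite eq = there (maxLetter-∈ y ys)

All-<-maxLetter : ∀ w {γ} → γ ⊆ w → maxLetter w ∉ γ → All (_< maxLetter w) γ
All-<-maxLetter w γ⊆w M∉γ = All.tabulate λ z∈γ →
  ≤∧≢⇒< (≤-maxLetter w (γ⊆w z∈γ)) λ { refl → M∉γ z∈γ }

stackSortFuel-suc : ∀ f x xs {α β} → splitAt∈ (maxLetter (x ∷ xs)) (x ∷ xs) ≡ (α , β) →
  stackSortFuel (suc f) (x ∷ xs) ≡ stackSortFuel f α ++ stackSortFuel f β ++ [ maxLetter (x ∷ xs) ]
stackSortFuel-suc f x xs split rewrite split = refl

length-++-∷-≤ : ∀ {f} (α β : List ℕ) {m} → length (α ++ m ∷ β) ≤ suc f → length α ≤ f × length β ≤ f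
length-++-∷-≤ {f} α β {m} len =
  ≤-trans (m≤m+n (length α) (length β)) len′ , ≤-trans (m≤n+m (length β) (length α)) len′
  where
  open ≤-Reasoning
  len′ : length α + length β ≤ f
  len′ = ≤-pred (begin
    suc (length α + length β)  ≡⟨ +-suc (length α) (length β) ⟨
    length α + suc (length β)  ≡⟨ length-++ α ⟨
    length (α ++ m ∷ β)        ≤⟨ len ⟩
    suc f                      ∎)

stackSort′≡stackSortFuel : ∀ f w → length w ≤ f → Unique w → stackSort′ w ≡ stackSortFuel f w
stackSort′≡stackSortFuel zero    []         _   _ = refl
stackSort′≡stackSortFuel (suc f) []         _   _ = refl
stackSort′≡stackSortFuel (suc f) w@(x ∷ xs) len u with ∈⇒first-occurrence (maxLetter-∈ x xs)
... | α , β , M∉α , w≡ with Unique-++⁻ α (subst Unique w≡ u)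
...   | uα , M∉β ∷ uβ , _ = begin
  stackSort′ w                                    ≡⟨ cong stackSort′ w≡ ⟩
  stackSort′ (α ++ M ∷ β)                         ≡⟨ stackSort′-++-∷ α β (subst Unique w≡ u) α<M β<M ⟩
  stackSort′ α ++ stackSort′ β ++ [ M ]           ≡⟨ cong₂ (λ s t → s ++ t ++ [ M ])
                                                       (stackSort′≡stackSortFuel f α lenα uα)
                                                       (stackSort′≡stackSortFuel f β lenβ uβ) ⟩
  stackSortFuel f α ++ stackSortFuel f β ++ [ M ] ≡⟨ stackSortFuel-suc f x xs
                                                       (trans (cong (splitAt∈ M) w≡) (splitAt∈-++-∷ α β M∉α)) ⟨
  stackSortFuel (suc f) w                         ∎
  where
  open ≡-Reasoning
  M = maxLetter w
  lenα×lenβ = length-++-∷-≤ α β (subst (λ v → length v ≤ suc f) w≡ len)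
  lenα = proj₁ lenα×lenβ
  lenβ = proj₂ lenα×lenβ
  in-w : α ++ M ∷ β ⊆ w
  in-w = subst (_ ∈_) (sym w≡)
  α<M : All (_< M) α
  α<M = All-<-maxLetter w (in-w ∘ ∈-++⁺ˡ) M∉α
  β<M : All (_< M) β
  β<M = All-<-maxLetter w (in-w ∘ ∈-++⁺ʳ α ∘ there) (All.All¬⇒¬Any M∉β)

proposition3p10 : (n : ℕ) (π : List ℕ) → π ↭ map suc (upTo n) → stackSort′ π ≡ stackSort π
proposition3p10 n π π↭ = stackSort′≡stackSortFuel (length π) π ≤-refl
  (Unique-resp-↭ (↭⇒↭ₛ (↭-sym π↭)) (Unique.map⁺ suc-injective (Unique.upTo⁺ n)))
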